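{- Let $k,m,n$ be integers with $3\leq k\leq\lfloor n/2\rfloor$, $m\geq 2$ and $n\geq 2k$. Then $$|\mathcal S^{(k)}_{m\times n}|=\begin{cases}\left(f_{2k-1}^{(k-1)}\right)^{m-2} & \text{if } n=2k,\\[4pt] f_{n-2k-1}^{(k-1)}\cdot\left(f_{n-2k+1}^{(k-1)}+d_{n-2k+2}^{(k)}\right)\cdot\left(f_{n-1}^{(k-1)}\right)^{m-2} & \text{if } n>2k.\end{cases}$$
   Context: A string "avoids $0^k$ and $1^k$" if it contains no $k$ consecutive equal symbols; $c^j$ denotes $j$ consecutive copies of the symbol $c$. $\mathcal S^{(k)}_{m\times n}$ is the set of binary $m\times n$ matrices $A$ such that: (i) the first row is $1^{k-1}\,0\,w_1\,1\,0^{k-1}$, where $0w_11$ is a binary string of length $n-2k+2$ avoiding $0^k$ and $1^k$; (ii) each row $i=2,\dots,m-1$ is a binary string of length $n$ ending with $0$ and avoiding $0^k$ and $1^k$; (iii) the last row is $1^k\,v_m\,0^k$, where $v_m$ is a binary string of length $n-2k$ avoiding $0^k$ and $1^k$. The $(k-1)$-generalized Fibonacci numbers are $f_n^{(k-1)}=2^n$ for $0\le n\le k-2$ and $f_n^{(k-1)}=f_{n-1}^{(k-1)}+\dots+f_{n-k+1}^{(k-1)}$ for $n\ge k-1$. Also $d_n^{(k)}=1$ if $n\equiv 0\pmod k$, $d_n^{(k)}=-1$ if $n\equiv 1\pmod k$, and $d_n^{(k)}=0$ otherwise. -}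

module Defs where

open import Data.Bool using (Bool; true; false; _∧_; _∨_; not; if_then_else_)
open import Data.Nat using (ℕ; zero; suc; _+_; _*_; _∸_; _^_; _<ᵇ_; _≡ᵇ_)
open import Data.Nat.DivMod using (_%_)
open import Data.List using (List; []; _∷_; _++_; replicate; take; drop; length; map; concatMap; filterᵇ)
open import Data.Nat.ListAction using (sum)
open import Data.Vec using (Vec; toList) renaming ([] to []ᵥ; _∷_ to _∷ᵥ_)
open import Data.Integer using (ℤ; +_; -_)

-- Bits: 0 = false, 1 = true.

_==ᵇ_ : Bool → Bool → Bool
true  ==ᵇ b = b
false ==ᵇ b = not b

_==ˡ_ : List Bool → List Bool → Bool
[]       ==ˡ []       = true
[]       ==ˡ (_ ∷ _)  = false
(_ ∷ _)  ==ˡ []       = false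
(x ∷ xs) ==ˡ (y ∷ ys) = (x ==ᵇ y) ∧ (xs ==ˡ ys)

startsWithRun : ℕ → Bool → List Bool → Bool
startsWithRun zero    c _        = true
startsWithRun (suc j) c []       = false
startsWithRun (suc j) c (x ∷ xs) = (x ==ᵇ c) ∧ startsWithRun j c xs

containsRun : ℕ → Bool → List Bool → Bool
containsRun j c []       = startsWithRun j c []
containsRun j c (x ∷ xs) = startsWithRun j c (x ∷ xs) ∨ containsRun j c xs

avoids : ℕ → List Bool → Bool
avoids k w = not (containsRun k false w ∨ containsRun k true w)

headIs : Bool → List Bool → Bool
headIs c []      = false
headIs c (x ∷ _) = x ==ᵇ c

lastIs : Bool → List Bool → Bool
lastIs c []           = false
lastIs c (x ∷ [])     = x ==ᵇ c
lastIs c (_ ∷ y ∷ ys) = lastIs c (y ∷ ys)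

firstRowOK : ℕ → ℕ → List Bool → Bool
firstRowOK k n r =
  let u = take (n ∸ 2 * k + 2) (drop (k ∸ 1) r) in
  (r ==ˡ (replicate (k ∸ 1) true ++ u ++ replicate (k ∸ 1) false))
  ∧ (length u ≡ᵇ (n ∸ 2 * k + 2))
  ∧ headIs false u ∧ lastIs true u ∧ avoids k u

middleRowOK : ℕ → List Bool → Bool
middleRowOK k r = lastIs false r ∧ avoids k r

lastRowOK : ℕ → ℕ → List Bool → Bool
lastRowOK k n r =
  let v = take (n ∸ 2 * k) (drop k r) in
  (r ==ˡ (replicate k true ++ v ++ replicate k false))
  ∧ (length v ≡ᵇ (n ∸ 2 * k)) ∧ avoids k v

restRowsOK : ℕ → ℕ → List (List Bool) → Bool
restRowsOK k n []           = false
restRowsOK k n (r ∷ [])     = lastRowOK k n r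
restRowsOK k n (r ∷ s ∷ rs) = middleRowOK k r ∧ restRowsOK k n (s ∷ rs)

rowsOK : ℕ → ℕ → List (List Bool) → Bool
rowsOK k n []       = false
rowsOK k n (r ∷ rs) = firstRowOK k n r ∧ restRowsOK k n rs

inS : (k : ℕ) {m n : ℕ} → Vec (Vec Bool n) m → Bool
inS k {m} {n} A = rowsOK k n (Data.List.map toList (toList A))

allVecsOf : {A : Set} → List A → (n : ℕ) → List (Vec A n)
allVecsOf xs zero    = []ᵥ ∷ []
allVecsOf xs (suc n) = concatMap (λ x → map (x ∷ᵥ_) (allVecsOf xs n)) xs

allMatrices : (m n : ℕ) → List (Vec (Vec Bool n) m)
allMatrices m n = allVecsOf (allVecsOf (false ∷ true ∷ []) n) m

cardS : (k m n : ℕ) → ℕ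
cardS k m n = length (filterᵇ (inS k) (allMatrices m n))

-- (r)-generalized Fibonacci numbers: f_n = 2^n for n ≤ r-1, else sum of previous r.
-- fibsDesc r n = [f_n, f_{n-1}, ..., f_0]
fibNext : ℕ → ℕ → List ℕ → ℕ
fibNext r n prev = if n <ᵇ r then 2 ^ n else sum (take r prev)

fibsDesc : ℕ → ℕ → List ℕ
fibsDesc r zero    = fibNext r zero [] ∷ []
fibsDesc r (suc n) = let l = fibsDesc r n in fibNext r (suc n) l ∷ l

fib : ℕ → ℕ → ℕ
fib r n = fibNext r n (drop 1 (fibsDesc r n))

d : ℕ → ℕ → ℤ
d zero    n = + 0
d (suc j) n =
  if (n % suc j) ≡ᵇ 0 then + 1
  else if (n % suc j) ≡ᵇ 1 then - (+ 1) else + 0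

module Submission where

-- Membership in S is a conjunction of independent conditions on the rows, so |S| is
-- (first rows) · (middle rows)^(m−2) · (last rows) (cardS-rows).  First and last rows consist of
-- constant blocks around an interior, so they are counted by their interiors (count-framed).
-- The remaining counts concern strings without k equal consecutive symbols.  We count the
-- continuations w of a block b^j by j and by whether b^j w ends in b (same) or not (diff):
-- one more symbol either lengthens the block or restarts it (ends-extend, ends-restart).  The
-- resulting recurrence unrolls to a window sum (BlockWindow.window).  For a fresh block the total
-- same + diff obeys the (k−1)-Fibonacci recurrence, so it is f_n (total-fib), and the imbalance
-- same − diff obeys the alternating recurrence solved by −d_{n+1}, because any k consecutive
-- values of d sum to 0 (imbalance-d).  So middle rows number f_{n−1}, last rows 2 f_{n−2k−1},
-- and first-row interiors (f_{n−2k+1} + d_{n−2k+2}) / 2; multiplying gives the theorem.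

open import Defs
open import Data.Nat using (ℕ; _≤_; _<_; _*_; _∸_; _+_; _/_)
open import Data.Integer using (ℤ; +_) renaming (_*_ to _*ℤ_; _+_ to _+ℤ_; _^_ to _^ℤ_)
open import Data.Product using (_×_)
open import Relation.Binary.PropositionalEquality using (_≡_)

open import Algebra.Properties.CommutativeSemigroup using (interchange)
open import Data.Bool using (Bool; true; false; _∧_; _∨_; not; if_then_else_; T)
open import Data.Bool.Properties using (∧-assoc; ∧-comm; ∨-zeroʳ; ∧-identityʳ)
open import Data.Empty using (⊥-elim)
open import Data.Integer using (-_; _-_)
import Data.Integer.Properties as ℤP
open import Data.List using (List; []; _∷_; _++_; map; take; drop; length; filterᵇ; replicate; concatMap; foldr)
open import Data.List.Properties using (map-++; ++-identityʳ; length-++; length-replicate; take-[]; take-all)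
open import Data.Nat using (zero; suc; _^_; s≤s; z≤n; _≡ᵇ_; _<ᵇ_)
open import Data.Nat.DivMod using ([m+n]%n≡m%n; m<n⇒m%n≡m)
open import Data.Nat.ListAction using (sum)
open import Data.Nat.ListAction.Properties using (sum-++)
open import Data.Nat.Properties
open import Data.Product using (_,_)
open import Data.Unit using (tt)
open import Data.Vec using (Vec; toList) renaming ([] to []ᵥ; _∷_ to _∷ᵥ_)
open import Relation.Binary.PropositionalEquality using (refl; sym; trans; cong; cong₂; subst; module ≡-Reasoning)
open import Relation.Nullary using (yes; no)
open ≡-Reasoning

ind : Bool → ℕ
ind true  = 1
ind false = 0

sumOver : {X : Set} → (X → ℕ) → List X → ℕ
sumOver f xs = sum (map f xs)

bitStrings : ℕ → List (List Bool)
bitStrings zero    = [] ∷ []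
bitStrings (suc n) = map (false ∷_) (bitStrings n) ++ map (true ∷_) (bitStrings n)

count : (List Bool → Bool) → ℕ → ℕ
count P n = sumOver (λ w → ind (P w)) (bitStrings n)

ind-∧ : ∀ a b → ind (a ∧ b) ≡ ind a * ind b
ind-∧ true  b = sym (+-identityʳ (ind b))
ind-∧ false b = refl

ind-split : ∀ a b → ind a ≡ ind (a ∧ b) + ind (a ∧ not b)
ind-split true  true  = refl
ind-split true  false = refl
ind-split false b     = refl

module _ {X : Set} where

  sumOver-++ : (f : X → ℕ) (xs ys : List X) → sumOver f (xs ++ ys) ≡ sumOver f xs + sumOver f ys
  sumOver-++ f xs ys = trans (cong sum (map-++ f xs ys)) (sum-++ (map f xs) (map f ys))

  sumOver-cong : {f g : X → ℕ} → (∀ x → f x ≡ g x) → (xs : List X) → sumOver f xs ≡ sumOver g xs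
  sumOver-cong e []       = refl
  sumOver-cong e (x ∷ xs) = cong₂ _+_ (e x) (sumOver-cong e xs)

  sumOver-+ : (f g : X → ℕ) (xs : List X) → sumOver (λ x → f x + g x) xs ≡ sumOver f xs + sumOver g xs
  sumOver-+ f g []       = refl
  sumOver-+ f g (x ∷ xs) = trans (cong (_+_ (f x + g x)) (sumOver-+ f g xs))
                                 (interchange +-commutativeSemigroup (f x) (g x) (sumOver f xs) (sumOver g xs))

  sumOver-*ˡ : (c : ℕ) (f : X → ℕ) (xs : List X) → sumOver (λ x → c * f x) xs ≡ c * sumOver f xs
  sumOver-*ˡ c f []       = sym (*-zeroʳ c)
  sumOver-*ˡ c f (x ∷ xs) = trans (cong (_+_ (c * f x)) (sumOver-*ˡ c f xs))
                                  (sym (*-distribˡ-+ c (f x) (sumOver f xs)))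

  sumOver-*ʳ : (c : ℕ) (f : X → ℕ) (xs : List X) → sumOver (λ x → f x * c) xs ≡ sumOver f xs * c
  sumOver-*ʳ c f xs = begin
    sumOver (λ x → f x * c) xs ≡⟨ sumOver-cong (λ x → *-comm (f x) c) xs ⟩
    sumOver (λ x → c * f x) xs ≡⟨ sumOver-*ˡ c f xs ⟩
    c * sumOver f xs           ≡⟨ *-comm c _ ⟩
    sumOver f xs * c           ∎

  sumOver-zero : (xs : List X) → sumOver (λ _ → 0) xs ≡ 0
  sumOver-zero []       = refl
  sumOver-zero (x ∷ xs) = sumOver-zero xs

sumOver-map : {X Y : Set} (f : Y → ℕ) (g : X → Y) (xs : List X) →
  sumOver f (map g xs) ≡ sumOver (λ x → f (g x)) xs
sumOver-map f g []       = refl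
sumOver-map f g (x ∷ xs) = cong (_+_ (f (g x))) (sumOver-map f g xs)

sumOver-bitStrings-suc : (f : List Bool → ℕ) (n : ℕ) →
  sumOver f (bitStrings (suc n)) ≡ sumOver (λ w → f (false ∷ w)) (bitStrings n) + sumOver (λ w → f (true ∷ w)) (bitStrings n)
sumOver-bitStrings-suc f n =
  trans (sumOver-++ f (map (false ∷_) (bitStrings n)) _)
        (cong₂ _+_ (sumOver-map f (false ∷_) (bitStrings n)) (sumOver-map f (true ∷_) (bitStrings n)))

sumOver-bitStrings-cong : ∀ n {f g : List Bool → ℕ} → (∀ w → length w ≡ n → f w ≡ g w) →
  sumOver f (bitStrings n) ≡ sumOver g (bitStrings n)
sumOver-bitStrings-cong zero    e = cong (_+ 0) (e [] refl)
sumOver-bitStrings-cong (suc n) {f} {g} e = begin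
  sumOver f (bitStrings (suc n))
    ≡⟨ sumOver-bitStrings-suc f n ⟩
  sumOver (λ w → f (false ∷ w)) (bitStrings n) + sumOver (λ w → f (true ∷ w)) (bitStrings n)
    ≡⟨ cong₂ _+_ (sumOver-bitStrings-cong n (λ w l → e (false ∷ w) (cong suc l)))
                 (sumOver-bitStrings-cong n (λ w l → e (true ∷ w) (cong suc l))) ⟩
  sumOver (λ w → g (false ∷ w)) (bitStrings n) + sumOver (λ w → g (true ∷ w)) (bitStrings n)
    ≡⟨ sym (sumOver-bitStrings-suc g n) ⟩
  sumOver g (bitStrings (suc n)) ∎

count-suc : (P : List Bool → Bool) (n : ℕ) →
  count P (suc n) ≡ count (λ w → P (false ∷ w)) n + count (λ w → P (true ∷ w)) n
count-suc P n = sumOver-bitStrings-suc (λ w → ind (P w)) n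

count-cong : {P Q : List Bool → Bool} (n : ℕ) → (∀ w → P w ≡ Q w) → count P n ≡ count Q n
count-cong n e = sumOver-cong (λ w → cong ind (e w)) (bitStrings n)

count-false : (n : ℕ) → count (λ _ → false) n ≡ 0
count-false n = sumOver-zero (bitStrings n)

count-++ : (P : List Bool → Bool) (a b : ℕ) →
  count P (a + b) ≡ sumOver (λ p → count (λ t → P (p ++ t)) b) (bitStrings a)
count-++ P zero    b = sym (+-identityʳ _)
count-++ P (suc a) b = begin
  count P (suc (a + b))
    ≡⟨ count-suc P (a + b) ⟩
  count (λ w → P (false ∷ w)) (a + b) + count (λ w → P (true ∷ w)) (a + b)
    ≡⟨ cong₂ _+_ (count-++ (λ w → P (false ∷ w)) a b) (count-++ (λ w → P (true ∷ w)) a b) ⟩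
  _ ≡⟨ sym (sumOver-bitStrings-suc (λ p → count (λ t → P (p ++ t)) b) a) ⟩
  sumOver (λ p → count (λ t → P (p ++ t)) b) (bitStrings (suc a)) ∎

count-product : (P A B : List Bool → Bool) (a b : ℕ) →
  (∀ p t → length p ≡ a → length t ≡ b → P (p ++ t) ≡ A p ∧ B t) →
  count P (a + b) ≡ count A a * count B b
count-product P A B a b factor = begin
  count P (a + b)
    ≡⟨ count-++ P a b ⟩
  sumOver (λ p → count (λ t → P (p ++ t)) b) (bitStrings a)
    ≡⟨ sumOver-bitStrings-cong a suffixCount ⟩
  sumOver (λ p → ind (A p) * count B b) (bitStrings a)
    ≡⟨ sumOver-*ʳ (count B b) (λ p → ind (A p)) (bitStrings a) ⟩
  count A a * count B b ∎
  where
  suffixCount : ∀ p → length p ≡ a → count (λ t → P (p ++ t)) b ≡ ind (A p) * count B b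
  suffixCount p lp =
    trans (sumOver-bitStrings-cong b (λ t lt → trans (cong ind (factor p t lp lt)) (ind-∧ (A p) (B t))))
          (sumOver-*ˡ (ind (A p)) (λ t → ind (B t)) (bitStrings b))

==ᵇ-refl : ∀ x → (x ==ᵇ x) ≡ true
==ᵇ-refl true  = refl
==ᵇ-refl false = refl

≡ᵇ-refl : ∀ n → (n ≡ᵇ n) ≡ true
≡ᵇ-refl zero    = refl
≡ᵇ-refl (suc n) = ≡ᵇ-refl n

count-exact : ∀ a (c : List Bool) → length c ≡ a → count (λ p → p ==ˡ c) a ≡ 1
count-exact zero    []          e = refl
count-exact (suc a) (false ∷ c) e = begin
  count (λ p → p ==ˡ (false ∷ c)) (suc a)      ≡⟨ count-suc _ a ⟩
  count (λ w → w ==ˡ c) a + count (λ _ → false) a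
    ≡⟨ cong₂ _+_ (count-exact a c (suc-injective e)) (count-false a) ⟩
  1 ∎
count-exact (suc a) (true ∷ c)  e = begin
  count (λ p → p ==ˡ (true ∷ c)) (suc a)       ≡⟨ count-suc _ a ⟩
  count (λ _ → false) a + count (λ w → w ==ˡ c) a
    ≡⟨ cong₂ _+_ (count-false a) (count-exact a c (suc-injective e)) ⟩
  1 ∎

take-prefix : ∀ a (p t : List Bool) → length p ≡ a → take a (p ++ t) ≡ p
take-prefix zero    []      t e = refl
take-prefix (suc a) (x ∷ p) t e = cong (x ∷_) (take-prefix a p t (suc-injective e))

drop-prefix : ∀ a (p t : List Bool) → length p ≡ a → drop a (p ++ t) ≡ t
drop-prefix zero    []      t e = refl
drop-prefix (suc a) (x ∷ p) t e = drop-prefix a p t (suc-injective e)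

length-take-≤ : ∀ b a (t : List Bool) → length t ≡ b + a → length (take b t) ≡ b
length-take-≤ zero    a t       e = refl
length-take-≤ (suc b) a (x ∷ t) e = cong suc (length-take-≤ b a t (suc-injective e))

==ˡ-++ : ∀ (p c x y : List Bool) → length p ≡ length c → (p ++ x) ==ˡ (c ++ y) ≡ (p ==ˡ c) ∧ (x ==ˡ y)
==ˡ-++ []      []      x y e = refl
==ˡ-++ (a ∷ p) (b ∷ c) x y e = trans (cong ((a ==ᵇ b) ∧_) (==ˡ-++ p c x y (suc-injective e)))
                                     (sym (∧-assoc (a ==ᵇ b) (p ==ˡ c) (x ==ˡ y)))

==ˡ-take : ∀ b (t z : List Bool) → t ==ˡ (take b t ++ z) ≡ drop b t ==ˡ z
==ˡ-take zero    t       z = refl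
==ˡ-take (suc b) []      z = refl
==ˡ-take (suc b) (x ∷ t) z rewrite ==ᵇ-refl x = ==ˡ-take b t z

-- The rows of the matrices in S are framed: r = c₁ ++ u ++ c₂ with fixed c₁, c₂ of lengths a, a'
-- and an interior u of length b subject to H.  Such rows correspond one-to-one to their interiors.
framed : ℕ → ℕ → List Bool → List Bool → (List Bool → Bool) → List Bool → Bool
framed a b c₁ c₂ H r = let u = take b (drop a r) in (r ==ˡ (c₁ ++ u ++ c₂)) ∧ (length u ≡ᵇ b) ∧ H u

count-framed : (a a' b : ℕ) (c₁ c₂ : List Bool) (H : List Bool → Bool) → length c₁ ≡ a → length c₂ ≡ a' →
  count (framed a b c₁ c₂ H) (a + (b + a')) ≡ count H b
count-framed a a' b c₁ c₂ H l₁ l₂ = begin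
  count (framed a b c₁ c₂ H) (a + (b + a'))
    ≡⟨ count-product _ (λ p → p ==ˡ c₁) interiorAndTail a (b + a') splitPrefix ⟩
  count (λ p → p ==ˡ c₁) a * count interiorAndTail (b + a')
    ≡⟨ cong₂ _*_ (count-exact a c₁ l₁) (count-product _ H (λ s → s ==ˡ c₂) b a' splitSuffix) ⟩
  1 * (count H b * count (λ s → s ==ˡ c₂) a')
    ≡⟨ cong (λ z → 1 * (count H b * z)) (count-exact a' c₂ l₂) ⟩
  1 * (count H b * 1)
    ≡⟨ trans (*-identityˡ _) (*-identityʳ _) ⟩
  count H b ∎
  where
  interiorAndTail : List Bool → Bool
  interiorAndTail t = H (take b t) ∧ (drop b t ==ˡ c₂)

  reorder : ∀ x y z → (x ∧ y) ∧ true ∧ z ≡ x ∧ (z ∧ y)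
  reorder true  y z = ∧-comm y z
  reorder false y z = refl

  splitPrefix : ∀ p t → length p ≡ a → length t ≡ b + a' →
    framed a b c₁ c₂ H (p ++ t) ≡ (p ==ˡ c₁) ∧ interiorAndTail t
  splitPrefix p t lp lt = begin
    framed a b c₁ c₂ H (p ++ t)
      ≡⟨ cong (λ u → ((p ++ t) ==ˡ (c₁ ++ u ++ c₂)) ∧ (length u ≡ᵇ b) ∧ H u) (cong (take b) (drop-prefix a p t lp)) ⟩
    ((p ++ t) ==ˡ (c₁ ++ take b t ++ c₂)) ∧ (length (take b t) ≡ᵇ b) ∧ H (take b t)
      ≡⟨ cong₂ (λ u v → u ∧ v ∧ H (take b t)) (==ˡ-++ p c₁ t (take b t ++ c₂) (trans lp (sym l₁)))
               (trans (cong (_≡ᵇ b) (length-take-≤ b a' t lt)) (≡ᵇ-refl b)) ⟩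
    ((p ==ˡ c₁) ∧ (t ==ˡ (take b t ++ c₂))) ∧ true ∧ H (take b t)
      ≡⟨ cong (λ u → ((p ==ˡ c₁) ∧ u) ∧ true ∧ H (take b t)) (==ˡ-take b t c₂) ⟩
    ((p ==ˡ c₁) ∧ (drop b t ==ˡ c₂)) ∧ true ∧ H (take b t)
      ≡⟨ reorder (p ==ˡ c₁) _ _ ⟩
    (p ==ˡ c₁) ∧ interiorAndTail t ∎

  splitSuffix : ∀ t s → length t ≡ b → length s ≡ a' → interiorAndTail (t ++ s) ≡ H t ∧ (s ==ˡ c₂)
  splitSuffix t s lt ls = cong₂ (λ u v → H u ∧ (v ==ˡ c₂)) (take-prefix b t s lt) (drop-prefix b t s lt)

toList-allVecsOf : ∀ n → map toList (allVecsOf (false ∷ true ∷ []) n) ≡ bitStrings n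
toList-allVecsOf zero    = refl
toList-allVecsOf (suc n) = begin
  map toList (map (false ∷ᵥ_) V ++ (map (true ∷ᵥ_) V ++ []))
    ≡⟨ map-++ toList (map (false ∷ᵥ_) V) _ ⟩
  map toList (map (false ∷ᵥ_) V) ++ map toList (map (true ∷ᵥ_) V ++ [])
    ≡⟨ cong (map toList (map (false ∷ᵥ_) V) ++_) (cong (map toList) (++-identityʳ _)) ⟩
  map toList (map (false ∷ᵥ_) V) ++ map toList (map (true ∷ᵥ_) V)
    ≡⟨ cong₂ _++_ (consRows false) (consRows true) ⟩
  map (false ∷_) (bitStrings n) ++ map (true ∷_) (bitStrings n) ∎
  where
  V = allVecsOf (false ∷ true ∷ []) n
  toList-cons : ∀ {m} (b : Bool) (vs : List (Vec Bool m)) → map toList (map (b ∷ᵥ_) vs) ≡ map (b ∷_) (map toList vs)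
  toList-cons b []       = refl
  toList-cons b (v ∷ vs) = cong (_ ∷_) (toList-cons b vs)
  consRows : ∀ b → map toList (map (b ∷ᵥ_) V) ≡ map (b ∷_) (bitStrings n)
  consRows b = trans (toList-cons b V) (cong (map (b ∷_)) (toList-allVecsOf n))

countRows : (p : List Bool → Bool) (n : ℕ) →
  sumOver (λ v → ind (p (toList v))) (allVecsOf (false ∷ true ∷ []) n) ≡ count p n
countRows p n = trans (sym (sumOver-map (λ w → ind (p w)) toList (allVecsOf (false ∷ true ∷ []) n)))
                      (cong (sumOver (λ w → ind (p w))) (toList-allVecsOf n))

length-filterᵇ : {X : Set} (p : X → Bool) (xs : List X) → length (filterᵇ p xs) ≡ sumOver (λ x → ind (p x)) xs
length-filterᵇ p []       = refl
length-filterᵇ p (x ∷ xs) with p x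
... | true  = cong suc (length-filterᵇ p xs)
... | false = length-filterᵇ p xs

vecs-product : {X : Set} {m : ℕ} (R : List X) (p : X → Bool) (q : Vec X m → Bool) (P : Vec X (suc m) → Bool) →
  (∀ x v → P (x ∷ᵥ v) ≡ p x ∧ q v) →
  sumOver (λ v → ind (P v)) (allVecsOf R (suc m)) ≡ sumOver (λ x → ind (p x)) R * sumOver (λ v → ind (q v)) (allVecsOf R m)
vecs-product {m = m} R p q P factor = go R
  where
  V = allVecsOf R m
  go : ∀ R' → sumOver (λ v → ind (P v)) (concatMap (λ y → map (y ∷ᵥ_) V) R')
             ≡ sumOver (λ x → ind (p x)) R' * sumOver (λ v → ind (q v)) V
  go []       = refl
  go (x ∷ R') = begin
    sumOver iP (map (x ∷ᵥ_) V ++ concatMap (λ y → map (y ∷ᵥ_) V) R')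
      ≡⟨ sumOver-++ iP (map (x ∷ᵥ_) V) _ ⟩
    sumOver iP (map (x ∷ᵥ_) V) + sumOver iP (concatMap (λ y → map (y ∷ᵥ_) V) R')
      ≡⟨ cong₂ _+_ firstRow (go R') ⟩
    ind (p x) * sumOver iq V + sumOver ip R' * sumOver iq V
      ≡⟨ sym (*-distribʳ-+ (sumOver iq V) (ind (p x)) (sumOver ip R')) ⟩
    (ind (p x) + sumOver ip R') * sumOver iq V ∎
    where
    iP = λ v → ind (P v)
    ip = λ y → ind (p y)
    iq = λ v → ind (q v)
    firstRow : sumOver iP (map (x ∷ᵥ_) V) ≡ ind (p x) * sumOver iq V
    firstRow = trans (sumOver-map iP (x ∷ᵥ_) V)
                 (trans (sumOver-cong (λ v → trans (cong ind (factor x v)) (ind-∧ (p x) (q v))) V)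
                        (sumOver-*ˡ (ind (p x)) iq V))

cardS-rows : ∀ k n j → cardS k (suc (suc j)) n ≡
  count (firstRowOK k n) n * (count (middleRowOK k) n ^ j * count (lastRowOK k n) n)
cardS-rows k n j = begin
  cardS k (suc (suc j)) n
    ≡⟨ length-filterᵇ (inS k) (allVecsOf R (suc (suc j))) ⟩
  sumOver (λ v → ind (inS k v)) (allVecsOf R (suc (suc j)))
    ≡⟨ vecs-product R (λ x → firstRowOK k n (toList x)) (restOK (suc j)) (inS k) (λ x v → refl) ⟩
  sumOver (λ x → ind (firstRowOK k n (toList x))) R * sumOver (λ v → ind (restOK (suc j) v)) (allVecsOf R (suc j))
    ≡⟨ cong₂ _*_ (countRows (firstRowOK k n) n) (countRest j) ⟩
  count (firstRowOK k n) n * (middle ^ j * last)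
    ≡⟨ cong₂ (λ u v → count (firstRowOK k n) n * (u ^ j * v)) (countRows (middleRowOK k) n) (countRows (lastRowOK k n) n) ⟩
  count (firstRowOK k n) n * (count (middleRowOK k) n ^ j * count (lastRowOK k n) n) ∎
  where
  R = allVecsOf (false ∷ true ∷ []) n
  restOK : ∀ m → Vec (Vec Bool n) m → Bool
  restOK m v = restRowsOK k n (map toList (toList v))
  middle = sumOver (λ x → ind (middleRowOK k (toList x))) R
  last   = sumOver (λ x → ind (lastRowOK k n (toList x))) R
  countRest : ∀ j → sumOver (λ v → ind (restOK (suc j) v)) (allVecsOf R (suc j)) ≡ middle ^ j * last
  countRest zero = begin
    sumOver (λ v → ind (restOK 1 v)) (allVecsOf R 1)
      ≡⟨ vecs-product R (λ x → lastRowOK k n (toList x)) (λ _ → true) (restOK 1) lastOnly ⟩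
    last * 1     ≡⟨ *-identityʳ last ⟩
    last         ≡⟨ sym (+-identityʳ last) ⟩
    1 * last     ∎
    where
    lastOnly : ∀ x (v : Vec (Vec Bool n) 0) → restOK 1 (x ∷ᵥ v) ≡ lastRowOK k n (toList x) ∧ true
    lastOnly x []ᵥ = sym (∧-identityʳ _)
  countRest (suc j) = begin
    sumOver (λ v → ind (restOK (suc (suc j)) v)) (allVecsOf R (suc (suc j)))
      ≡⟨ vecs-product R (λ x → middleRowOK k (toList x)) (restOK (suc j)) (restOK (suc (suc j))) middleFirst ⟩
    middle * sumOver (λ v → ind (restOK (suc j) v)) (allVecsOf R (suc j))
      ≡⟨ cong (middle *_) (countRest j) ⟩
    middle * (middle ^ j * last) ≡⟨ sym (*-assoc middle (middle ^ j) last) ⟩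
    middle ^ suc j * last ∎
    where
    middleFirst : ∀ x (v : Vec (Vec Bool n) (suc j)) →
      restOK (suc (suc j)) (x ∷ᵥ v) ≡ middleRowOK k (toList x) ∧ restOK (suc j) v
    middleFirst x (y ∷ᵥ v) = refl

-- Sequences X j n, indexed by the length j < k of the current block and the number n of symbols
-- still to come, that obey  X j (n+1) = u n ∙ [j+1 < k] X (j+1) n  unroll to a sum over a window
-- of the last k − j inflows u (n−1), …, u 0, c.
module BlockWindow {A : Set} (_∙_ : A → A → A) (ε : A) (∙-identityʳ : ∀ x → x ∙ ε ≡ x) (k : ℕ) where

  guard : Bool → A → A
  guard g x = if g then x else ε

  ∑ : List A → A
  ∑ = foldr _∙_ ε

  inflows : (ℕ → A) → A → ℕ → List A
  inflows u c zero    = c ∷ []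
  inflows u c (suc n) = u n ∷ inflows u c n

  ∑-window : ∀ j → j < k → (x : A) (xs : List A) → ∑ (take (k ∸ j) (x ∷ xs)) ≡ x ∙ ∑ (take (k ∸ suc j) xs)
  ∑-window j j<k x xs rewrite +-∸-assoc 1 j<k = refl

  window : (X : ℕ → ℕ → A) (u : ℕ → A) (c : A) →
    (∀ j → X j zero ≡ c) →
    (∀ j n → X j (suc n) ≡ u n ∙ guard (suc j <ᵇ k) (X (suc j) n)) →
    ∀ n j → j < k → X j n ≡ ∑ (take (k ∸ j) (inflows u c n))
  window X u c X-zero X-suc zero j j<k = begin
    X j zero                            ≡⟨ X-zero j ⟩
    c                                   ≡⟨ sym (∙-identityʳ c) ⟩
    c ∙ ∑ []                            ≡⟨ cong (λ xs → c ∙ ∑ xs) (sym (take-[] (k ∸ suc j))) ⟩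
    c ∙ ∑ (take (k ∸ suc j) [])         ≡⟨ sym (∑-window j j<k c []) ⟩
    ∑ (take (k ∸ j) (inflows u c zero)) ∎
  window X u c X-zero X-suc (suc n) j j<k = begin
    X j (suc n)                                 ≡⟨ X-suc j n ⟩
    u n ∙ guard (suc j <ᵇ k) (X (suc j) n)      ≡⟨ cong (u n ∙_) guarded ⟩
    u n ∙ ∑ (take (k ∸ suc j) (inflows u c n))  ≡⟨ sym (∑-window j j<k (u n) _) ⟩
    ∑ (take (k ∸ j) (inflows u c (suc n)))      ∎
    where
    guarded : guard (suc j <ᵇ k) (X (suc j) n) ≡ ∑ (take (k ∸ suc j) (inflows u c n))
    guarded with suc j <ᵇ k in eq
    ... | true  = window X u c X-zero X-suc n (suc j) (<ᵇ⇒< (suc j) k (subst T (sym eq) tt))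
    ... | false = cong (λ i → ∑ (take i (inflows u c n)))
                       (sym (m≤n⇒m∸n≡0 (≮⇒≥ {suc j} {k} (λ lt → subst T eq (<⇒<ᵇ lt)))))

-- Runs.  A block b^j followed by a symbol different from b contains no run of length > j,
-- so for j < K it does not influence whether a run of length K occurs.

startsWithRun-replicate : ∀ j K b ys → j ≤ K →
  startsWithRun K b (replicate j b ++ ys) ≡ startsWithRun (K ∸ j) b ys
startsWithRun-replicate zero    K       b ys h       = refl
startsWithRun-replicate (suc j) (suc K) b ys (s≤s h) rewrite ==ᵇ-refl b = startsWithRun-replicate j K b ys h

startsWithRun-blocked : ∀ m b ys → headIs b ys ≡ false → startsWithRun (suc m) b ys ≡ false
startsWithRun-blocked m b []       e = refl
startsWithRun-blocked m b (y ∷ ys) e = cong (_∧ startsWithRun m b ys) e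

noRunInOwnBlock : ∀ j K b ys → suc j ≤ K → headIs b ys ≡ false →
  startsWithRun (suc K) b (replicate (suc j) b ++ ys) ≡ false
noRunInOwnBlock j K b ys h hy = begin
  startsWithRun (suc K) b (b ∷ replicate j b ++ ys) ≡⟨ cong (_∧ startsWithRun K b (replicate j b ++ ys)) (==ᵇ-refl b) ⟩
  startsWithRun K b (replicate j b ++ ys)           ≡⟨ startsWithRun-replicate j K b ys (≤-trans (n≤1+n j) h) ⟩
  startsWithRun (K ∸ j) b ys                        ≡⟨ cong (λ i → startsWithRun i b ys) (+-∸-assoc 1 h) ⟩
  startsWithRun (suc (K ∸ suc j)) b ys              ≡⟨ startsWithRun-blocked _ b ys hy ⟩
  false                                             ∎

noRunInBlock : ∀ j K c b ys → suc j ≤ K → headIs b ys ≡ false →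
  startsWithRun (suc K) c (replicate (suc j) b ++ ys) ≡ false
noRunInBlock j K true  true  ys           = noRunInOwnBlock j K true ys
noRunInBlock j K false false ys           = noRunInOwnBlock j K false ys
noRunInBlock j K true  false ys h hy = refl
noRunInBlock j K false true  ys h hy = refl

containsRun-block : ∀ j K c b ys → j < K → headIs b ys ≡ false →
  containsRun K c (replicate j b ++ ys) ≡ containsRun K c ys
containsRun-block zero    K       c b ys h       hy = refl
containsRun-block (suc j) (suc K) c b ys (s≤s h) hy =
  cong₂ _∨_ (noRunInBlock j K c b ys h hy) (containsRun-block j (suc K) c b ys (m≤n⇒m≤1+n h) hy)

avoids-block : ∀ k j b ys → j < k → headIs b ys ≡ false → avoids k (replicate j b ++ ys) ≡ avoids k ys
avoids-block k j b ys h hy =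
  cong₂ (λ u v → not (u ∨ v)) (containsRun-block j k false b ys h hy) (containsRun-block j k true b ys h hy)

replicate-snoc : ∀ j (b : Bool) xs → replicate j b ++ b ∷ xs ≡ replicate (suc j) b ++ xs
replicate-snoc zero    b xs = refl
replicate-snoc (suc j) b xs = cong (b ∷_) (replicate-snoc j b xs)

containsRun-full : ∀ k' b xs → containsRun (suc k') b (replicate (suc k') b ++ xs) ≡ true
containsRun-full k' b xs =
  cong (_∨ containsRun (suc k') b (replicate k' b ++ xs))
       (trans (startsWithRun-replicate (suc k') (suc k') b xs ≤-refl)
              (cong (λ i → startsWithRun i b xs) (n∸n≡0 (suc k'))))

avoids-full-block : ∀ k' b xs → avoids (suc k') (replicate (suc k') b ++ xs) ≡ false
avoids-full-block k' true  xs =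
  cong not (trans (cong (containsRun (suc k') false (replicate (suc k') true ++ xs) ∨_) (containsRun-full k' true xs))
                  (∨-zeroʳ _))
avoids-full-block k' false xs =
  cong (λ z → not (z ∨ containsRun (suc k') true (replicate (suc k') false ++ xs))) (containsRun-full k' false xs)

count-suc-by : (b : Bool) (P : List Bool → Bool) (n : ℕ) →
  count P (suc n) ≡ count (λ w → P (b ∷ w)) n + count (λ w → P (not b ∷ w)) n
count-suc-by false P n = count-suc P n
count-suc-by true  P n = trans (count-suc P n) (+-comm (count (λ w → P (false ∷ w)) n) _)

lastIs-complement : ∀ b w → lastIs false (b ∷ w) ≡ not (lastIs true (b ∷ w))
lastIs-complement true  []      = refl
lastIs-complement false []      = refl
lastIs-complement b     (x ∷ w) = lastIs-complement x w

count-by-last : (P : List Bool → Bool) (b : Bool) (n : ℕ) →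
  count P n ≡ count (λ w → P w ∧ lastIs true (b ∷ w)) n + count (λ w → P w ∧ lastIs false (b ∷ w)) n
count-by-last P b n = trans (sumOver-cong byLast (bitStrings n)) (sumOver-+ _ _ (bitStrings n))
  where
  byLast : ∀ w → ind (P w) ≡ ind (P w ∧ lastIs true (b ∷ w)) + ind (P w ∧ lastIs false (b ∷ w))
  byLast w = trans (ind-split (P w) (lastIs true (b ∷ w)))
                   (cong (λ l → ind (P w ∧ lastIs true (b ∷ w)) + ind (P w ∧ l)) (sym (lastIs-complement b w)))

not-==ᵇ : ∀ b → (not b ==ᵇ b) ≡ false
not-==ᵇ true  = refl
not-==ᵇ false = refl

pos-^ : ∀ b j → + (b ^ j) ≡ (+ b) ^ℤ j
pos-^ b zero    = refl
pos-^ b (suc j) = trans (ℤP.pos-* b (b ^ j)) (cong ((+ b) *ℤ_) (pos-^ b j))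

module Runs (t : ℕ) where

  k : ℕ
  k = suc (suc t)

  one<k : 1 < k
  one<k = s≤s (s≤s z≤n)

  module ℕW = BlockWindow _+_ 0 +-identityʳ k
  module ℤW = BlockWindow _+ℤ_ (+ 0) ℤP.+-identityʳ k

  ends : ℕ → Bool → Bool → List Bool → Bool
  ends j b c w = avoids k (replicate j b ++ w) ∧ lastIs c (b ∷ w)

  ends-extend : ∀ j b c w → j < k → ends j b c (b ∷ w) ≡ (suc j <ᵇ k) ∧ ends (suc j) b c w
  ends-extend j b c w j<k = trans (cong (λ u → avoids k u ∧ lastIs c (b ∷ w)) (replicate-snoc j b w)) bounded
    where
    bounded : ends (suc j) b c w ≡ (suc j <ᵇ k) ∧ ends (suc j) b c w
    bounded with suc j <ᵇ k in eq
    ... | true  = refl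
    ... | false = cong (_∧ lastIs c (b ∷ w))
                       (subst (λ i → avoids k (replicate i b ++ w) ≡ false)
                              (sym (≤-antisym j<k (≮⇒≥ {suc j} {k} (λ lt → subst T eq (<⇒<ᵇ lt)))))
                              (avoids-full-block (suc t) b w))

  ends-restart : ∀ j b c w → j < k → ends j b c (not b ∷ w) ≡ ends 1 (not b) c w
  ends-restart j b c w j<k = cong (_∧ lastIs c (not b ∷ w)) (avoids-block k j b (not b ∷ w) j<k (not-==ᵇ b))

  -- same j n / diff j n: the continuations of length n of a block of length j ending with the
  -- block's symbol / with the other symbol, computed by the recurrence of the two lemmas above
  same diff : ℕ → ℕ → ℕ
  same j zero    = 1
  same j (suc n) = ℕW.guard (suc j <ᵇ k) (same (suc j) n) + diff 1 n
  diff j zero    = 0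
  diff j (suc n) = ℕW.guard (suc j <ᵇ k) (diff (suc j) n) + same 1 n

  endCount : Bool → ℕ → ℕ → ℕ
  endCount true  = same
  endCount false = diff

  endCount-step : ∀ b c j n → endCount (b ==ᵇ c) j (suc n) ≡
    ℕW.guard (suc j <ᵇ k) (endCount (b ==ᵇ c) (suc j) n) + endCount (not b ==ᵇ c) 1 n
  endCount-step true  true  j n = refl
  endCount-step true  false j n = refl
  endCount-step false true  j n = refl
  endCount-step false false j n = refl

  count-guard : ∀ g P n → count (λ w → g ∧ P w) n ≡ ℕW.guard g (count P n)
  count-guard true  P n = refl
  count-guard false P n = count-false n

  count-ends : ∀ n j b c → j < k → count (ends j b c) n ≡ endCount (b ==ᵇ c) j n
  count-ends zero j b c j<k =
    trans (cong (λ a → ind (a ∧ (b ==ᵇ c)) + 0) (avoids-block k j b [] j<k refl)) (emptyContinuation (b ==ᵇ c))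
    where
    emptyContinuation : ∀ e → ind e + 0 ≡ endCount e j zero
    emptyContinuation true  = refl
    emptyContinuation false = refl
  count-ends (suc n) j b c j<k = begin
    count (ends j b c) (suc n)
      ≡⟨ count-suc-by b (ends j b c) n ⟩
    count (λ w → ends j b c (b ∷ w)) n + count (λ w → ends j b c (not b ∷ w)) n
      ≡⟨ cong₂ _+_ (count-cong n (λ w → ends-extend j b c w j<k)) (count-cong n (λ w → ends-restart j b c w j<k)) ⟩
    count (λ w → (suc j <ᵇ k) ∧ ends (suc j) b c w) n + count (ends 1 (not b) c) n
      ≡⟨ cong₂ _+_ (trans (count-guard (suc j <ᵇ k) (ends (suc j) b c) n) extended) (count-ends n 1 (not b) c one<k) ⟩
    ℕW.guard (suc j <ᵇ k) (endCount (b ==ᵇ c) (suc j) n) + endCount (not b ==ᵇ c) 1 n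
      ≡⟨ sym (endCount-step b c j n) ⟩
    endCount (b ==ᵇ c) j (suc n) ∎
    where
    extended : ℕW.guard (suc j <ᵇ k) (count (ends (suc j) b c) n) ≡ ℕW.guard (suc j <ᵇ k) (endCount (b ==ᵇ c) (suc j) n)
    extended with suc j <ᵇ k in eq
    ... | true  = count-ends n (suc j) b c (<ᵇ⇒< (suc j) k (subst T (sym eq) tt))
    ... | false = refl

  total : ℕ → ℕ → ℕ
  total j n = same j n + diff j n

  count-block : ∀ n j b → j < k → count (λ w → avoids k (replicate j b ++ w)) n ≡ total j n
  count-block n j b j<k =
    trans (count-by-last _ b n) (trans (cong₂ _+_ (count-ends n j b true j<k) (count-ends n j b false j<k)) (byLast b))
    where
    byLast : ∀ b → endCount (b ==ᵇ true) j n + endCount (b ==ᵇ false) j n ≡ total j n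
    byLast true  = refl
    byLast false = +-comm (diff j n) (same j n)

  count-middleRow : ∀ n → count (middleRowOK k) (suc n) ≡ total 1 n
  count-middleRow n = begin
    count (middleRowOK k) (suc n)
      ≡⟨ count-suc (middleRowOK k) n ⟩
    count (λ w → middleRowOK k (false ∷ w)) n + count (λ w → middleRowOK k (true ∷ w)) n
      ≡⟨ cong₂ _+_ (count-cong n (λ w → ∧-comm (lastIs false (false ∷ w)) (avoids k (false ∷ w))))
                   (count-cong n (λ w → ∧-comm (lastIs false (true ∷ w)) (avoids k (true ∷ w)))) ⟩
    count (ends 1 false false) n + count (ends 1 true false) n
      ≡⟨ cong₂ _+_ (count-ends n 1 false false one<k) (count-ends n 1 true false one<k) ⟩
    total 1 n ∎

  interiorOK : List Bool → Bool
  interiorOK u = headIs false u ∧ lastIs true u ∧ avoids k u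

  count-interior : ∀ n → count interiorOK (suc n) ≡ diff 1 n
  count-interior n = begin
    count interiorOK (suc n)
      ≡⟨ count-suc interiorOK n ⟩
    count (λ w → interiorOK (false ∷ w)) n + count (λ w → interiorOK (true ∷ w)) n
      ≡⟨ cong₂ _+_ (count-cong n (λ w → ∧-comm (lastIs true (false ∷ w)) (avoids k (false ∷ w)))) (count-false n) ⟩
    count (ends 1 false true) n + 0
      ≡⟨ +-identityʳ _ ⟩
    count (ends 1 false true) n
      ≡⟨ count-ends n 1 false true one<k ⟩
    diff 1 n ∎

  count-avoids : ∀ n → count (avoids k) (suc n) ≡ total 1 n + total 1 n
  count-avoids n = trans (count-suc (avoids k) n) (cong₂ _+_ (count-block n 1 false one<k) (count-block n 1 true one<k))

  total-step : ∀ j n → total j (suc n) ≡ total 1 n + ℕW.guard (suc j <ᵇ k) (total (suc j) n)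
  total-step j n = byGuard (suc j <ᵇ k)
    where
    rearrange : ∀ s d' d s' → (s + d') + (d + s') ≡ (s' + d') + (s + d)
    rearrange = solve-∀
      where open import Data.Nat.Tactic.RingSolver
    byGuard : ∀ g → (ℕW.guard g (same (suc j) n) + diff 1 n) + (ℕW.guard g (diff (suc j) n) + same 1 n)
                    ≡ total 1 n + ℕW.guard g (total (suc j) n)
    byGuard true  = rearrange (same (suc j) n) (diff 1 n) (diff (suc j) n) (same 1 n)
    byGuard false = trans (+-comm (diff 1 n) (same 1 n)) (sym (+-identityʳ _))

  r : ℕ
  r = suc t

  -- f_{n−1}, …, f_0, 1: the list of which f_n is the sum of the first r entries
  fibsBelow : ℕ → List ℕ
  fibsBelow = ℕW.inflows (fib r) 1

  fibsBelow-suc : ∀ n → fibsBelow (suc n) ≡ fibsDesc r n ++ 1 ∷ []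
  fibsBelow-suc zero    = refl
  fibsBelow-suc (suc n) = cong (fib r (suc n) ∷_) (fibsBelow-suc n)

  length-fibsDesc : ∀ n → length (fibsDesc r n) ≡ suc n
  length-fibsDesc zero    = refl
  length-fibsDesc (suc n) = cong suc (length-fibsDesc n)

  fib-initial : ∀ m → m < r → fib r m ≡ 2 ^ m
  fib-initial zero    m<r = refl
  fib-initial (suc m) m<r = byCase (suc m <ᵇ r) refl
    where
    byCase : ∀ g → g ≡ (suc m <ᵇ r) → (if g then 2 ^ suc m else sum (take r (fibsDesc r m))) ≡ 2 ^ suc m
    byCase true  e = refl
    byCase false e = ⊥-elim (subst T (sym e) (<⇒<ᵇ m<r))

  fib-initial-sum : ∀ m → m < r → sum (fibsDesc r m) + 1 ≡ 2 ^ suc m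
  fib-initial-sum zero    m<r = refl
  fib-initial-sum (suc m) m<r = begin
    fib r (suc m) + sum (fibsDesc r m) + 1   ≡⟨ +-assoc (fib r (suc m)) _ 1 ⟩
    fib r (suc m) + (sum (fibsDesc r m) + 1) ≡⟨ cong₂ _+_ (fib-initial (suc m) m<r) (fib-initial-sum m (<-trans (n<1+n m) m<r)) ⟩
    2 ^ suc m + 2 ^ suc m                    ≡⟨ cong (_+_ (2 ^ suc m)) (sym (+-identityʳ _)) ⟩
    2 ^ suc (suc m)                          ∎

  take-++-short : ∀ j (xs ys : List ℕ) → j ≤ length xs → take j (xs ++ ys) ≡ take j xs
  take-++-short zero    xs       ys h       = refl
  take-++-short (suc j) (x ∷ xs) ys (s≤s h) = cong (x ∷_) (take-++-short j xs ys h)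

  fib-window : ∀ n → ℕW.∑ (take r (fibsBelow n)) ≡ fib r n
  fib-window zero    = cong (λ xs → 1 + ℕW.∑ xs) (take-[] t)
  fib-window (suc m) = trans (cong (λ xs → ℕW.∑ (take r xs)) (fibsBelow-suc m)) (byCase (suc m <ᵇ r) refl)
    where
    xs = fibsDesc r m
    byCase : ∀ g → g ≡ (suc m <ᵇ r) → sum (take r (xs ++ 1 ∷ [])) ≡ (if g then 2 ^ suc m else sum (take r xs))
    byCase true  e = begin
      sum (take r (xs ++ 1 ∷ [])) ≡⟨ cong sum (take-all r (xs ++ 1 ∷ []) short) ⟩
      sum (xs ++ 1 ∷ [])          ≡⟨ sum-++ xs (1 ∷ []) ⟩
      sum xs + 1                  ≡⟨ fib-initial-sum m (<-trans (n<1+n m) sm<r) ⟩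
      2 ^ suc m                   ∎
      where
      sm<r : suc m < r
      sm<r = <ᵇ⇒< (suc m) r (subst T e tt)
      short : length (xs ++ 1 ∷ []) ≤ r
      short = subst (_≤ r) (sym (trans (length-++ xs) (trans (cong (_+ 1) (length-fibsDesc m)) (+-comm (suc m) 1)))) sm<r
    byCase false e = cong sum (take-++-short r xs _ (subst (r ≤_) (sym (length-fibsDesc m))
                                                          (≮⇒≥ (λ lt → subst T (sym e) (<⇒<ᵇ lt)))))

  total-window : ∀ n j → j < k → total j n ≡ ℕW.∑ (take (k ∸ j) (ℕW.inflows (total 1) 1 n))
  total-window = ℕW.window total (total 1) 1 (λ j → refl) total-step

  total-fib : ∀ n → total 1 n ≡ fib r n
  inflows-total : ∀ n → ℕW.inflows (total 1) 1 n ≡ fibsBelow n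
  total-fib n = begin
    total 1 n                                           ≡⟨ total-window n 1 one<k ⟩
    ℕW.∑ (take r (ℕW.inflows (total 1) 1 n))            ≡⟨ cong (λ xs → ℕW.∑ (take r xs)) (inflows-total n) ⟩
    ℕW.∑ (take r (fibsBelow n))                         ≡⟨ fib-window n ⟩
    fib r n                                             ∎
  inflows-total zero    = refl
  inflows-total (suc n) = cong₂ _∷_ (total-fib n) (inflows-total n)

  imbalance : ℕ → ℕ → ℤ
  imbalance j n = + same j n - + diff j n

  imbalance-step : ∀ j n → imbalance j (suc n) ≡ - imbalance 1 n +ℤ ℤW.guard (suc j <ᵇ k) (imbalance (suc j) n)
  imbalance-step j n = byGuard (suc j <ᵇ k)
    where
    S = same (suc j) n
    D = diff (suc j) n
    rearrange : ∀ s d₁ d s₁ → (s +ℤ d₁) - (d +ℤ s₁) ≡ - (s₁ - d₁) +ℤ (s - d)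
    rearrange = solve-∀
      where open import Data.Integer.Tactic.RingSolver
    negate : ∀ d₁ s₁ → d₁ - s₁ ≡ - (s₁ - d₁) +ℤ + 0
    negate = solve-∀
      where open import Data.Integer.Tactic.RingSolver
    byGuard : ∀ g → + (ℕW.guard g S + diff 1 n) - + (ℕW.guard g D + same 1 n)
                    ≡ - imbalance 1 n +ℤ ℤW.guard g (imbalance (suc j) n)
    byGuard true  = trans (cong₂ _-_ (ℤP.pos-+ S (diff 1 n)) (ℤP.pos-+ D (same 1 n)))
                          (rearrange (+ S) (+ diff 1 n) (+ D) (+ same 1 n))
    byGuard false = negate (+ diff 1 n) (+ same 1 n)

  residueSign : ℕ → ℤ
  residueSign i = if i ≡ᵇ 0 then + 1 else if i ≡ᵇ 1 then - (+ 1) else + 0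

  d-periodic : ∀ p → d k (p + k) ≡ d k p
  d-periodic p = cong residueSign ([m+n]%n≡m%n p k)

  d-middle : ∀ q → suc (suc q) < k → d k (suc (suc q)) ≡ + 0
  d-middle q h = cong residueSign (m<n⇒m%n≡m h)

  dsBelow : ℕ → List ℤ
  dsBelow = ℤW.inflows (λ m → d k (suc m)) (d k 0)

  length-dsBelow : ∀ n → length (dsBelow n) ≡ suc n
  length-dsBelow zero    = refl
  length-dsBelow (suc n) = cong suc (length-dsBelow n)

  ∑-take-last : ∀ j p → ℤW.∑ (take (suc j) (dsBelow (j + p))) ≡ ℤW.∑ (take j (dsBelow (j + p))) +ℤ d k p
  ∑-take-last zero    zero    = trans (ℤP.+-identityʳ (d k 0)) (sym (ℤP.+-identityˡ (d k 0)))
  ∑-take-last zero    (suc p) = trans (ℤP.+-identityʳ (d k (suc p))) (sym (ℤP.+-identityˡ (d k (suc p))))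
  ∑-take-last (suc j) p       = trans (cong (d k (suc (j + p)) +ℤ_) (∑-take-last j p))
                                      (sym (ℤP.+-assoc (d k (suc (j + p))) _ _))

  balanced : ℕ → Set
  balanced n = d k (suc n) +ℤ ℤW.∑ (take r (dsBelow n)) ≡ + 0

  -- shifting a window one step adds d (p + k) and drops d p, which are equal
  balanced-shift : ∀ p → balanced (t + p) → balanced (suc (t + p))
  balanced-shift p ih = begin
    d k (suc (suc (t + p))) +ℤ (d k (suc (t + p)) +ℤ X)
      ≡⟨ cong (_+ℤ (d k (suc (t + p)) +ℤ X)) (trans (cong (d k) (+-comm k p)) (d-periodic p)) ⟩
    d k p +ℤ (d k (suc (t + p)) +ℤ X)
      ≡⟨ rotate (d k p) (d k (suc (t + p))) X ⟩
    d k (suc (t + p)) +ℤ (X +ℤ d k p)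
      ≡⟨ cong (d k (suc (t + p)) +ℤ_) (sym (∑-take-last t p)) ⟩
    d k (suc (t + p)) +ℤ ℤW.∑ (take r (dsBelow (t + p)))
      ≡⟨ ih ⟩
    + 0 ∎
    where
    X = ℤW.∑ (take t (dsBelow (t + p)))
    rotate : ∀ a b x → a +ℤ (b +ℤ x) ≡ b +ℤ (x +ℤ a)
    rotate = solve-∀
      where open import Data.Integer.Tactic.RingSolver

  -- windows within the initial segment are 1 − 1 + 0 + … + 0; later ones follow by periodicity
  window-zero : ∀ n → balanced n
  window-zero zero = cong (λ xs → d k 1 +ℤ ℤW.∑ (d k 0 ∷ xs)) (take-[] t)
  window-zero (suc n) with n <? t
  ... | yes n<t = begin
    d k (suc (suc n)) +ℤ (d k (suc n) +ℤ ℤW.∑ (take t (dsBelow n)))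
      ≡⟨ cong₂ (λ a xs → a +ℤ (d k (suc n) +ℤ ℤW.∑ xs)) (d-middle n (s≤s (s≤s n<t))) (trans whole (sym wholeʳ)) ⟩
    + 0 +ℤ (d k (suc n) +ℤ ℤW.∑ (take r (dsBelow n)))
      ≡⟨ ℤP.+-identityˡ _ ⟩
    d k (suc n) +ℤ ℤW.∑ (take r (dsBelow n))
      ≡⟨ window-zero n ⟩
    + 0 ∎
    where
    whole : take t (dsBelow n) ≡ dsBelow n
    whole = take-all t (dsBelow n) (subst (_≤ t) (sym (length-dsBelow n)) n<t)
    wholeʳ : take r (dsBelow n) ≡ dsBelow n
    wholeʳ = take-all r (dsBelow n) (subst (_≤ r) (sym (length-dsBelow n)) (m≤n⇒m≤1+n n<t))
  ... | no n≮t = subst (λ m → balanced m → balanced (suc m)) (m+[n∸m]≡n (≮⇒≥ n≮t)) (balanced-shift (n ∸ t)) (window-zero n)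

  imbalance-window : ∀ n j → j < k → imbalance j n ≡ ℤW.∑ (take (k ∸ j) (ℤW.inflows (λ m → - imbalance 1 m) (d k 0) n))
  imbalance-window = ℤW.window imbalance (λ m → - imbalance 1 m) (d k 0) (λ j → refl) imbalance-step

  imbalance-d : ∀ n → - imbalance 1 n ≡ d k (suc n)
  inflows-imbalance : ∀ n → ℤW.inflows (λ m → - imbalance 1 m) (d k 0) n ≡ dsBelow n
  imbalance-d n = begin
    - imbalance 1 n                                            ≡⟨ cong -_ (imbalance-window n 1 one<k) ⟩
    - ℤW.∑ (take r (ℤW.inflows (λ m → - imbalance 1 m) (d k 0) n)) ≡⟨ cong (λ xs → - ℤW.∑ (take r xs)) (inflows-imbalance n) ⟩
    - ℤW.∑ (take r (dsBelow n))                                ≡⟨ negate-balanced (d k (suc n)) _ (window-zero n) ⟩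
    d k (suc n)                                                ∎
    where
    cancel : ∀ a s → - s ≡ a +ℤ - (a +ℤ s)
    cancel = solve-∀
      where open import Data.Integer.Tactic.RingSolver
    negate-balanced : ∀ a s → a +ℤ s ≡ + 0 → - s ≡ a
    negate-balanced a s a+s≡0 = trans (cancel a s) (trans (cong (λ z → a +ℤ - z) a+s≡0) (ℤP.+-identityʳ a))
  inflows-imbalance zero    = refl
  inflows-imbalance (suc n) = cong₂ _∷_ (imbalance-d n) (inflows-imbalance n)

  diff-double : ∀ n → + (diff 1 n + diff 1 n) ≡ + fib r n +ℤ d k (suc n)
  diff-double n = begin
    + (D + D)                      ≡⟨ ℤP.pos-+ D D ⟩
    + D +ℤ + D                     ≡⟨ halves (+ S) (+ D) ⟩
    (+ S +ℤ + D) +ℤ - (+ S - + D)  ≡⟨ cong₂ _+ℤ_ (trans (sym (ℤP.pos-+ S D)) (cong +_ (total-fib n))) (imbalance-d n) ⟩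
    + fib r n +ℤ d k (suc n)       ∎
    where
    S = same 1 n
    D = diff 1 n
    halves : ∀ s d → d +ℤ d ≡ (s +ℤ d) +ℤ - (s - d)
    halves = solve-∀
      where open import Data.Integer.Tactic.RingSolver

  cardS-by-rows : ∀ j n → 2 * k ≤ n → cardS k (suc (suc j)) n ≡
    count interiorOK (n ∸ 2 * k + 2) * (fib r (n ∸ 1) ^ j * count (avoids k) (n ∸ 2 * k))
  cardS-by-rows j n 2k≤n = begin
    cardS k (suc (suc j)) n
      ≡⟨ cardS-rows k n j ⟩
    count (firstRowOK k n) n * (count (middleRowOK k) n ^ j * count (lastRowOK k n) n)
      ≡⟨ cong₂ (λ a b → a * (b ^ j * count (lastRowOK k n) n)) firstRows middleRows ⟩
    count interiorOK (x + 2) * (fib r (n ∸ 1) ^ j * count (lastRowOK k n) n)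
      ≡⟨ cong (λ c → count interiorOK (x + 2) * (fib r (n ∸ 1) ^ j * c)) lastRows ⟩
    count interiorOK (x + 2) * (fib r (n ∸ 1) ^ j * count (avoids k) x) ∎
    where
    x = n ∸ 2 * k
    n≡2k+x : n ≡ 2 * k + x
    n≡2k+x = sym (m+[n∸m]≡n 2k≤n)
    firstFrame : ∀ t x → 2 * suc (suc t) + x ≡ suc t + ((x + 2) + suc t)
    firstFrame = solve-∀
      where open import Data.Nat.Tactic.RingSolver
    lastFrame : ∀ t x → 2 * suc (suc t) + x ≡ suc (suc t) + (x + suc (suc t))
    lastFrame = solve-∀
      where open import Data.Nat.Tactic.RingSolver
    firstRows : count (firstRowOK k n) n ≡ count interiorOK (x + 2)
    firstRows = trans (cong (count (firstRowOK k n)) (trans n≡2k+x (firstFrame t x)))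
                      (count-framed (suc t) (suc t) (x + 2) (replicate (suc t) true) (replicate (suc t) false) interiorOK
                                    (length-replicate (suc t)) (length-replicate (suc t)))
    lastRows : count (lastRowOK k n) n ≡ count (avoids k) x
    lastRows = trans (cong (count (lastRowOK k n)) (trans n≡2k+x (lastFrame t x)))
                     (count-framed k k x (replicate k true) (replicate k false) (avoids k)
                                   (length-replicate k) (length-replicate k))
    middleRows : count (middleRowOK k) n ≡ fib r (n ∸ 1)
    middleRows = subst (λ m → count (middleRowOK k) m ≡ fib r (m ∸ 1)) (sym n≡2k+x)
                       (trans (count-middleRow (2 * k + x ∸ 1)) (total-fib (2 * k + x ∸ 1)))

  rowProduct : ∀ x B j → 0 < x →
    + (count interiorOK (x + 2) * (B ^ j * count (avoids k) x)) ≡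
    (+ fib r (x ∸ 1)) *ℤ ((+ fib r (x + 1)) +ℤ d k (x + 2)) *ℤ ((+ B) ^ℤ j)
  rowProduct (suc c) B j _ = begin
    + (count interiorOK (suc c + 2) * (B ^ j * count (avoids k) (suc c)))
      ≡⟨ cong₂ (λ u v → + (u * (B ^ j * v))) interior (trans (count-avoids c) (cong₂ _+_ (total-fib c) (total-fib c))) ⟩
    + (D * (B ^ j * (f + f)))
      ≡⟨ cong +_ (regroup D (B ^ j) f) ⟩
    + (f * (D + D) * B ^ j)
      ≡⟨ trans (ℤP.pos-* (f * (D + D)) (B ^ j)) (cong₂ _*ℤ_ (ℤP.pos-* f (D + D)) (pos-^ B j)) ⟩
    + f *ℤ + (D + D) *ℤ (+ B) ^ℤ j
      ≡⟨ cong (λ z → + f *ℤ z *ℤ (+ B) ^ℤ j) (diff-double (suc (suc c))) ⟩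
    + f *ℤ (+ fib r (suc (suc c)) +ℤ d k (suc (suc (suc c)))) *ℤ (+ B) ^ℤ j
      ≡⟨ cong₂ (λ u v → + f *ℤ (+ fib r u +ℤ d k v) *ℤ (+ B) ^ℤ j) (sym (+-comm (suc c) 1)) (sym (+-comm (suc c) 2)) ⟩
    (+ fib r c) *ℤ ((+ fib r (suc c + 1)) +ℤ d k (suc c + 2)) *ℤ ((+ B) ^ℤ j) ∎
    where
    f = fib r c
    D = diff 1 (suc (suc c))
    interior : count interiorOK (suc c + 2) ≡ D
    interior = trans (cong (count interiorOK) (+-comm (suc c) 2)) (count-interior (suc (suc c)))
    regroup : ∀ a p g → a * (p * (g + g)) ≡ g * (a + a) * p
    regroup = solve-∀
      where open import Data.Nat.Tactic.RingSolver

mainTheorem4 : (k m n : ℕ) → 3 ≤ k → k ≤ n / 2 → 2 ≤ m → 2 * k ≤ n →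
    (n ≡ 2 * k → + cardS k m n ≡ (+ fib (k ∸ 1) (2 * k ∸ 1)) ^ℤ (m ∸ 2))
    × (2 * k < n → + cardS k m n ≡
        (+ fib (k ∸ 1) (n ∸ 2 * k ∸ 1))
          *ℤ ((+ fib (k ∸ 1) (n ∸ 2 * k + 1)) +ℤ d k (n ∸ 2 * k + 2))
          *ℤ ((+ fib (k ∸ 1) (n ∸ 1)) ^ℤ (m ∸ 2)))
mainTheorem4 (suc (suc (suc t))) (suc (suc j)) n (s≤s (s≤s (s≤s z≤n))) _ (s≤s (s≤s z≤n)) 2k≤n =
  equalCase , largerCase
  where
  open Runs (suc t)
  x = n ∸ 2 * k

  equalCase : n ≡ 2 * k → + cardS k (suc (suc j)) n ≡ (+ fib r (2 * k ∸ 1)) ^ℤ j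
  equalCase n≡2k = begin
    + cardS k (suc (suc j)) n
      ≡⟨ cong +_ (cardS-by-rows j n 2k≤n) ⟩
    + (count interiorOK (x + 2) * (fib r (n ∸ 1) ^ j * count (avoids k) x))
      ≡⟨ cong₂ (λ y m → + (count interiorOK (y + 2) * (fib r (m ∸ 1) ^ j * count (avoids k) y)))
               (trans (cong (_∸ 2 * k) n≡2k) (n∸n≡0 (2 * k))) n≡2k ⟩
    + (count interiorOK 2 * (fib r (2 * k ∸ 1) ^ j * 1))
      ≡⟨ cong +_ (trans (*-identityˡ _) (*-identityʳ _)) ⟩
    + (fib r (2 * k ∸ 1) ^ j)
      ≡⟨ pos-^ (fib r (2 * k ∸ 1)) j ⟩
    (+ fib r (2 * k ∸ 1)) ^ℤ j ∎

  largerCase : 2 * k < n → + cardS k (suc (suc j)) n ≡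
    (+ fib r (x ∸ 1)) *ℤ ((+ fib r (x + 1)) +ℤ d k (x + 2)) *ℤ ((+ fib r (n ∸ 1)) ^ℤ j)
  largerCase 2k<n = trans (cong +_ (cardS-by-rows j n 2k≤n)) (rowProduct x (fib r (n ∸ 1)) j (m<n⇒0<n∸m 2k<n))
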